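{- Let $t$ be a positive integer and let $G$ be a $B_t$-free bipartite graph with parts $V_1,V_2$, where $|V_i|=n_i$ and $n=n_1+n_2$. If $n$ is sufficiently large, then for $\{i,j\}=\{1,2\}$, \[ N_i(C_4,G)\;\ge\;\frac12\binom{t}{2}\left(\sum_{u\in V_i} d(u)^2-(2t-1)\,e(G)-(t-1)\,n_j^2\right). \]
   Context: $B_t$ is the graph consisting of $t$ copies of $C_4$ sharing one common edge (otherwise disjoint), i.e. $K_2\,\square\,S_t$. For $S\subseteq V(G)$, $N(S)$ is the set of common neighbours of all vertices of $S$ and $d(S)=|N(S)|$; $d(u)$ is the degree of $u$. A set $S$ is good if $d(S)\ge |S|+1$. For the bipartite graph $G$ with parts $V_1,V_2$, $N_i(C_4,G)$ denotes the number of copies $C$ of $C_4$ in $G$ for which there exists a good set $S$ of size $t$ with $V(C)\cap V_i\subseteq S$. $e(G)$ is the number of edges. -}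

module Defs where

open import Data.Bool using (Bool; true; false; _∧_; _∨_; not; T)
open import Data.Nat using (ℕ; zero; suc; _+_; _*_; _^_; _≤ᵇ_; _≡ᵇ_; _<ᵇ_)
open import Data.Fin using (Fin; toℕ)
open import Data.Fin.Subset using (Subset; ∣_∣)
open import Data.Fin.Subset.Properties using (anySubset?)
open import Data.Vec using (lookup)
open import Data.Sum using (_⊎_; inj₁; inj₂)
open import Data.Product using (Σ; ∃; _×_; _,_; proj₁; proj₂)
open import Data.List.Base using (List; []; _∷_; map; _++_; length; filter; filterᵇ; allFin; cartesianProduct; all)
open import Data.Nat.ListAction using (sum)
open import Data.Maybe using (Maybe; just; nothing)
open import Data.Unit using (⊤)
open import Data.Empty using (⊥)
open import Relation.Nullary using (¬_; Dec; yes; no)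
open import Relation.Binary.PropositionalEquality using (_≡_; _≢_)
open import Function.Definitions using (Injective)

BipGraph : ℕ → ℕ → Set
BipGraph n₁ n₂ = Fin n₁ → Fin n₂ → Bool

Vtx : ℕ → ℕ → Set
Vtx n₁ n₂ = Fin n₁ ⊎ Fin n₂

adj : ∀ {n₁ n₂} → BipGraph n₁ n₂ → Vtx n₁ n₂ → Vtx n₁ n₂ → Bool
adj G (inj₁ a) (inj₂ b) = G a b
adj G (inj₂ b) (inj₁ a) = G a b
adj G (inj₁ _) (inj₁ _) = false
adj G (inj₂ _) (inj₂ _) = false

data Part : Set where
  one two : Part

partSize : ∀ (n₁ n₂ : ℕ) → Part → ℕ
partSize n₁ n₂ one = n₁
partSize n₁ n₂ two = n₂

inPart : ∀ {n₁ n₂} → Part → Vtx n₁ n₂ → Bool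
inPart one (inj₁ _) = true
inPart one (inj₂ _) = false
inPart two (inj₁ _) = false
inPart two (inj₂ _) = true

vertices : ∀ n₁ n₂ → List (Vtx n₁ n₂)
vertices n₁ n₂ = map inj₁ (allFin n₁) ++ map inj₂ (allFin n₂)

partVertices : ∀ n₁ n₂ → Part → List (Vtx n₁ n₂)
partVertices n₁ n₂ i = filterᵇ (inPart i) (vertices n₁ n₂)

countV : ∀ {n₁ n₂} → (Vtx n₁ n₂ → Bool) → ℕ
countV {n₁} {n₂} p = length (filterᵇ p (vertices n₁ n₂))

degree : ∀ {n₁ n₂} → BipGraph n₁ n₂ → Vtx n₁ n₂ → ℕ
degree G u = countV (adj G u)

edges : ∀ {n₁ n₂} → BipGraph n₁ n₂ → ℕ
edges {n₁} {n₂} G =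
  length (filterᵇ (λ p → G (proj₁ p) (proj₂ p)) (cartesianProduct (allFin n₁) (allFin n₂)))

sumDegSq : ∀ {n₁ n₂} → BipGraph n₁ n₂ → Part → ℕ
sumDegSq {n₁} {n₂} G i = sum (map (λ u → degree G u ^ 2) (partVertices n₁ n₂ i))

VSet : ℕ → ℕ → Set
VSet n₁ n₂ = Subset n₁ × Subset n₂

memᵇ : ∀ {n₁ n₂} → VSet n₁ n₂ → Vtx n₁ n₂ → Bool
memᵇ S (inj₁ a) = lookup (proj₁ S) a
memᵇ S (inj₂ b) = lookup (proj₂ S) b

size : ∀ {n₁ n₂} → VSet n₁ n₂ → ℕ
size S = ∣ proj₁ S ∣ + ∣ proj₂ S ∣

commonNbrᵇ : ∀ {n₁ n₂} → BipGraph n₁ n₂ → VSet n₁ n₂ → Vtx n₁ n₂ → Bool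
commonNbrᵇ {n₁} {n₂} G S v = all (λ u → not (memᵇ S u) ∨ adj G u v) (vertices n₁ n₂)

dS : ∀ {n₁ n₂} → BipGraph n₁ n₂ → VSet n₁ n₂ → ℕ
dS G S = countV (commonNbrᵇ G S)

goodᵇ : ∀ {n₁ n₂} → BipGraph n₁ n₂ → VSet n₁ n₂ → Bool
goodᵇ G S = suc (size S) ≤ᵇ dS G S

-- Since G is bipartite, every
-- copy of C₄ has two vertices a < a' in V₁ and two vertices b < b' in V₂
-- with all four edges ab, ab', a'b, a'b' present, and conversely each such
-- choice spans exactly one copy of C₄ (K₂,₂ = C₄).

C4Cand : ℕ → ℕ → Set
C4Cand n₁ n₂ = (Fin n₁ × Fin n₁) × (Fin n₂ × Fin n₂)

isC4ᵇ : ∀ {n₁ n₂} → BipGraph n₁ n₂ → C4Cand n₁ n₂ → Bool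
isC4ᵇ G ((a , a') , (b , b')) =
  (toℕ a <ᵇ toℕ a') ∧ (toℕ b <ᵇ toℕ b') ∧
  G a b ∧ G a b' ∧ G a' b ∧ G a' b'

c4copies : ∀ {n₁ n₂} → BipGraph n₁ n₂ → List (C4Cand n₁ n₂)
c4copies {n₁} {n₂} G =
  filterᵇ (isC4ᵇ G)
    (cartesianProduct (cartesianProduct (allFin n₁) (allFin n₁))
                      (cartesianProduct (allFin n₂) (allFin n₂)))

c4verts : ∀ {n₁ n₂} → C4Cand n₁ n₂ → List (Vtx n₁ n₂)
c4verts ((a , a') , (b , b')) = inj₁ a ∷ inj₁ a' ∷ inj₂ b ∷ inj₂ b' ∷ []

witnessᵇ : ∀ {n₁ n₂} → ℕ → BipGraph n₁ n₂ → Part → C4Cand n₁ n₂ → VSet n₁ n₂ → Bool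
witnessᵇ t G i C S =
  (size S ≡ᵇ t) ∧ goodᵇ G S ∧ all (λ v → not (inPart i v) ∨ memᵇ S v) (c4verts C)

HasGoodSet : ∀ {n₁ n₂} → ℕ → BipGraph n₁ n₂ → Part → C4Cand n₁ n₂ → Set
HasGoodSet t G i C = ∃ λ S → T (witnessᵇ t G i C S)

hasGoodSet? : ∀ {n₁ n₂} t (G : BipGraph n₁ n₂) i C → Dec (HasGoodSet t G i C)
hasGoodSet? t G i C with anySubset? (λ S₁ → anySubset? (λ S₂ → T? (witnessᵇ t G i C (S₁ , S₂))))
  where
    T? : ∀ b → Dec (T b)
    T? true  = yes _
    T? false = no (λ ())
... | yes (S₁ , S₂ , w) = yes ((S₁ , S₂) , w)
... | no ¬p = no (λ { ((S₁ , S₂) , w) → ¬p (S₁ , S₂ , w) })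

N-C4 : ∀ {n₁ n₂} → ℕ → BipGraph n₁ n₂ → Part → ℕ
N-C4 t G i = length (filter (hasGoodSet? t G i) (c4copies G))

-- B_t = K₂ □ S_t.  Vertices: (s , u) with s ∈ V(K₂) = Bool and
-- u ∈ V(S_t) = Maybe (Fin t) (nothing = centre of the star, just k = leaf k).

BVtx : ℕ → Set
BVtx t = Bool × Maybe (Fin t)

K2Adj : Bool → Bool → Set
K2Adj s s' = s ≢ s'

StarAdj : ∀ {t} → Maybe (Fin t) → Maybe (Fin t) → Set
StarAdj nothing  (just _) = ⊤
StarAdj (just _) nothing  = ⊤
StarAdj nothing  nothing  = ⊥
StarAdj (just _) (just _) = ⊥

BAdj : ∀ {t} → BVtx t → BVtx t → Set
BAdj (s , u) (s' , u') = (s ≡ s' × StarAdj u u') ⊎ (u ≡ u' × K2Adj s s')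

BtCopy : ∀ {n₁ n₂} → ℕ → BipGraph n₁ n₂ → Set
BtCopy {n₁} {n₂} t G =
  Σ (BVtx t → Vtx n₁ n₂) λ f →
    Injective _≡_ _≡_ f × (∀ p q → BAdj p q → T (adj G (f p) (f q)))

BtFree : ∀ {n₁ n₂} → ℕ → BipGraph n₁ n₂ → Set
BtFree t G = ¬ BtCopy t G

-- Σ_{u ∈ V_i} d(u)² is the sum of the codegrees codeg(b, y) = |N(b) ∩ N(y)| over all ordered
-- pairs (b, y) of vertices of V_j.  The diagonal b = y contributes e(G), pairs of codegree at most
-- t − 1 contribute at most (t − 1) n_j², and a pair of codegree t whose common neighbourhood S is
-- a good set (a good pair) contributes t = (t − 1) + 1.  Call the remaining pairs b ≠ y of
-- codegree ≥ t heavy.  If some vertex x ~ b had t heavy partners y₁, …, y_t among its neighbours,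
-- the sets N(b) ∩ N(yᵢ) ∖ {x}, each of size ≥ t − 1, would have distinct representatives
-- (greedily when one of them has size ≥ t; otherwise all codegrees are t, N(b) ∩ N(y₁) is not
-- good although b, y₁, …, y_t are t + 1 candidate common neighbours of it, so some vertex of it
-- misses some yₗ and can be used first), and x, b, the yᵢ and their representatives span a B_t.
-- Hence heavy pairs contribute at most (t − 1) e(G), and
--   Σ d(u)² ≤ t e(G) + (t − 1) n_j² + 2 · #good pairs.
-- A good pair {b, y} with S = N(b) ∩ N(y) spans C(t, 2) copies of C₄ on b, y and two vertices
-- of S, each counted by N_i(C₄, G) with witness S.  The bound holds for every n, so n₀ = 0.

module Submission where

open import Defs
open import Data.Nat using (ℕ; _+_; _*_; _∸_; _≤_; _^_)
open import Data.Nat.Combinatorics using (_C_)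
open import Data.Product using (∃-syntax)
open import Data.Integer using (ℤ; +_; _-_) renaming (_*_ to _*ℤ_; _≤_ to _≤ℤ_)
open import Relation.Binary.PropositionalEquality using (_≢_)

open import Data.Bool using (Bool; true; false; T; not; _∧_; _∨_)
open import Data.Bool.Properties using (T-∧; ∧-zeroʳ; ∧-identityʳ; ∧-comm; ∧-idem)
open import Data.Nat using (zero; suc; _<_; z≤n; s≤s; _<ᵇ_) renaming (_≟_ to _≟ℕ_)
open import Data.Nat.Properties hiding (_≟_; suc-injective; 0≢1+n)
open import Data.Nat.Combinatorics using (nC1≡n; nCk+nC[k+1]≡[n+1]C[k+1])
open import Data.Nat.Solver using (module +-*-Solver)
import Data.Nat.ListAction as List
open import Data.Nat.ListAction.Properties using (sum-++)
open import Data.Integer using (-_; _⊖_; +≤+) renaming (_+_ to _+ℤ_)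
import Data.Integer.Properties as ℤ
open import Data.Fin using (Fin; zero; suc; toℕ; _≟_)
open import Data.Fin.Properties using (suc-injective; 0≢1+n; any?; all?; ¬∀⟶∃¬; toℕ-injective)
open import Data.Fin.Subset using (Subset; ⊥; ∣_∣)
open import Data.Fin.Subset.Properties using (∣⊥∣≡0)
open import Data.List using (List; []; _∷_; map; _++_; length; filter; filterᵇ; tabulate; allFin; cartesianProduct; all)
open import Data.List.Properties using (map-++; map-∘; map-cong)
open import Data.List.Relation.Unary.All using (universal)
open import Data.List.Relation.Unary.All.Properties using (all⁻)
open import Data.Vec as Vec using (lookup)
open import Data.Vec.Properties using (lookup∘tabulate; lookup-replicate)
open import Data.Maybe using (nothing; just)
open import Data.Product using (∃; ∃₂; _×_; _,_; proj₁; proj₂)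
open import Data.Sum using (inj₁; inj₂)
open import Data.Sum.Properties using (inj₁-injective; inj₂-injective)
open import Data.Unit using (tt)
open import Data.Empty using (⊥-elim)
open import Function using (_∘_; id; Equivalence; mk⇔)
open import Function.Definitions using (Injective)
open import Relation.Nullary using (¬_; Dec; does; yes; no)
open import Relation.Nullary.Decidable using (T?; ¬?; _×-dec_; _→-dec_; does-⇔; dec-true; dec-false)
open import Relation.Unary using (Pred; Decidable)
open import Relation.Binary.Definitions using (tri<; tri≈; tri>)
open import Relation.Binary.PropositionalEquality
  using (_≡_; refl; sym; trans; cong; cong₂; subst; module ≡-Reasoning)
open import Algebra.Properties.Semiring.Sum +-*-semiring
  using (sum; sum-syntax; ∑-distrib-+; ∑-comm; *-distribˡ-sum; *-distribʳ-sum; sum-cong-≗; sum-replicate-zero)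

open Equivalence using (to; from)

𝟙 : Bool → ℕ
𝟙 true  = 1
𝟙 false = 0

𝟙-∧ : ∀ a b → 𝟙 (a ∧ b) ≡ 𝟙 a * 𝟙 b
𝟙-∧ true  b = sym (+-identityʳ (𝟙 b))
𝟙-∧ false b = refl

𝟙-true : ∀ {a} → T a → 𝟙 a ≡ 1
𝟙-true {true} _ = refl

𝟙-false : ∀ {a} → ¬ T a → 𝟙 a ≡ 0
𝟙-false {true}  ¬a = ⊥-elim (¬a tt)
𝟙-false {false} _  = refl

𝟙≤1 : ∀ a → 𝟙 a ≤ 1
𝟙≤1 true  = s≤s z≤n
𝟙≤1 false = z≤n

𝟙-mono-≤ : ∀ {a b} → (T a → T b) → 𝟙 a ≤ 𝟙 b
𝟙-mono-≤ {false}         _   = z≤n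
𝟙-mono-≤ {true}  {true}  _   = ≤-refl
𝟙-mono-≤ {true}  {false} a⇒b = ⊥-elim (a⇒b tt)

𝟙-*-cong : ∀ {a} {u v : ℕ} → (T a → u ≡ v) → 𝟙 a * u ≡ 𝟙 a * v
𝟙-*-cong {true}  u≡v = cong (_+ 0) (u≡v tt)
𝟙-*-cong {false} _   = refl

infixr 6 _∧⁺_
_∧⁺_ : ∀ {a b} → T a → T b → T (a ∧ b)
p ∧⁺ q = from T-∧ (p , q)

⇒not∨ : ∀ {a b} → (T a → T b) → T (not a ∨ b)
⇒not∨ {true}  a⇒b = a⇒b tt
⇒not∨ {false} _   = tt

¬⇒⇒×¬ : ∀ {a b} → ¬ (T a → T b) → T a × ¬ T b
¬⇒⇒×¬ {true}  ¬a⇒b = tt , λ b → ¬a⇒b (λ _ → b)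
¬⇒⇒×¬ {false} ¬a⇒b = ⊥-elim (¬a⇒b λ ())

does⁺ : ∀ {a} {A : Set a} (a? : Dec A) → A → T (does a?)
does⁺ (yes _)  _ = tt
does⁺ (no  ¬a) a = ¬a a

does⁻ : ∀ {a} {A : Set a} (a? : Dec A) → T (does a?) → A
does⁻ (yes a) _ = a

∑-mono-≤ : ∀ {n} {f g : Fin n → ℕ} → (∀ i → f i ≤ g i) → ∑[ i < n ] f i ≤ ∑[ i < n ] g i
∑-mono-≤ {zero}  f≤g = z≤n
∑-mono-≤ {suc n} f≤g = +-mono-≤ (f≤g zero) (∑-mono-≤ (f≤g ∘ suc))

∑-const : ∀ n c → ∑[ i < n ] c ≡ n * c
∑-const zero    c = refl
∑-const (suc n) c = cong (_+_ c) (∑-const n c)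

∑-δ : ∀ {n} (x : Fin n) (f : Fin n → ℕ) → ∑[ y < n ] (𝟙 (does (x ≟ y)) * f y) ≡ f x
∑-δ {suc n} zero    f =
  trans (cong₂ _+_ (+-identityʳ (f zero)) (sum-replicate-zero n)) (+-identityʳ (f zero))
∑-δ {suc n} (suc x) f = ∑-δ x (f ∘ suc)

∑₄-swap : ∀ {a b} (f : Fin a → Fin a → Fin b → Fin b → ℕ) →
  ∑[ x < a ] ∑[ x′ < a ] ∑[ y < b ] ∑[ y′ < b ] f x x′ y y′ ≡
  ∑[ y < b ] ∑[ y′ < b ] ∑[ x < a ] ∑[ x′ < a ] f x x′ y y′
∑₄-swap {a} {b} f = begin
  ∑[ x < a ] ∑[ x′ < a ] ∑[ y < b ] ∑[ y′ < b ] f x x′ y y′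
    ≡⟨ sum-cong-≗ (λ x → ∑-comm (λ x′ y → ∑[ y′ < b ] f x x′ y y′)) ⟩
  ∑[ x < a ] ∑[ y < b ] ∑[ x′ < a ] ∑[ y′ < b ] f x x′ y y′
    ≡⟨ ∑-comm (λ x y → ∑[ x′ < a ] ∑[ y′ < b ] f x x′ y y′) ⟩
  ∑[ y < b ] ∑[ x < a ] ∑[ x′ < a ] ∑[ y′ < b ] f x x′ y y′
    ≡⟨ sum-cong-≗ (λ y → sum-cong-≗ (λ x → ∑-comm (λ x′ y′ → f x x′ y y′))) ⟩
  ∑[ y < b ] ∑[ x < a ] ∑[ y′ < b ] ∑[ x′ < a ] f x x′ y y′
    ≡⟨ sum-cong-≗ (λ y → ∑-comm (λ x y′ → ∑[ x′ < a ] f x x′ y y′)) ⟩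
  ∑[ y < b ] ∑[ y′ < b ] ∑[ x < a ] ∑[ x′ < a ] f x x′ y y′ ∎
  where open ≡-Reasoning

count : ∀ {n} → (Fin n → Bool) → ℕ
count {n} p = ∑[ i < n ] 𝟙 (p i)

count-mono-≤ : ∀ {n} {p q : Fin n → Bool} → (∀ i → T (p i) → T (q i)) → count p ≤ count q
count-mono-≤ p⇒q = ∑-mono-≤ (λ i → 𝟙-mono-≤ (p⇒q i))

count-witness : ∀ {n} (p : Fin n → Bool) → 1 ≤ count p → ∃ λ z → T (p z)
count-witness {suc n} p 1≤count with p zero in p₀
... | true  = zero , subst T (sym p₀) tt
... | false = let z , pz = count-witness (p ∘ suc) 1≤count in suc z , pz

delete : ∀ {n} → Fin n → (Fin n → Bool) → Fin n → Bool
delete x p z = p z ∧ not (does (x ≟ z))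

delete⁺ : ∀ {n} {z : Fin n} (x : Fin n) (p : Fin n → Bool) → T (p z) → x ≢ z → T (delete x p z)
delete⁺ {z = z} x p pz x≢z with x ≟ z
... | yes x≡z = ⊥-elim (x≢z x≡z)
... | no  _   = pz ∧⁺ tt

delete⁻ : ∀ {n} {z : Fin n} (x : Fin n) (p : Fin n → Bool) → T (delete x p z) → T (p z) × x ≢ z
delete⁻ {z = z} x p del with x ≟ z
... | yes _   = ⊥-elim (proj₂ (to T-∧ del))
... | no  x≢z = proj₁ (to T-∧ del) , x≢z

count-delete : ∀ {n} (x : Fin n) (p : Fin n → Bool) → count p ≡ 𝟙 (p x) + count (delete x p)
count-delete {n} x p = begin
  count p
    ≡⟨ sum-cong-≗ split ⟩
  ∑[ z < n ] (𝟙 (does (x ≟ z)) * 𝟙 (p z) + 𝟙 (delete x p z))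
    ≡⟨ ∑-distrib-+ (λ z → 𝟙 (does (x ≟ z)) * 𝟙 (p z)) (𝟙 ∘ delete x p) ⟩
  ∑[ z < n ] (𝟙 (does (x ≟ z)) * 𝟙 (p z)) + count (delete x p)
    ≡⟨ cong (_+ count (delete x p)) (∑-δ x (𝟙 ∘ p)) ⟩
  𝟙 (p x) + count (delete x p) ∎
  where
  open ≡-Reasoning
  split : ∀ z → 𝟙 (p z) ≡ 𝟙 (does (x ≟ z)) * 𝟙 (p z) + 𝟙 (delete x p z)
  split z with x ≟ z
  ... | yes _ = trans (sym (+-identityʳ _)) (cong₂ _+_ (sym (+-identityʳ _)) (cong 𝟙 (sym (∧-zeroʳ (p z)))))
  ... | no  _ = cong 𝟙 (sym (∧-identityʳ (p z)))

count≤suc-delete : ∀ {n} (x : Fin n) (p : Fin n → Bool) → count p ≤ suc (count (delete x p))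
count≤suc-delete x p = subst (_≤ suc (count (delete x p))) (sym (count-delete x p))
  (+-monoˡ-≤ (count (delete x p)) (𝟙≤1 (p x)))

count-delete-absent : ∀ {n} {x : Fin n} (p : Fin n → Bool) → ¬ T (p x) → count (delete x p) ≡ count p
count-delete-absent {x = x} p ¬px =
  sym (trans (count-delete x p) (cong (_+ count (delete x p)) (𝟙-false ¬px)))

fresh : ∀ {n k} (g : Fin n → Fin k) (p : Fin k → Bool) → suc n ≤ count p →
  ∃ λ z → T (p z) × (∀ i → g i ≢ z)
fresh {zero}  g p n<|p| = let z , pz = count-witness p n<|p| in z , pz , λ ()
fresh {suc n} g p n<|p|
  with fresh (g ∘ suc) (delete (g zero) p) (≤-pred (≤-trans n<|p| (count≤suc-delete (g zero) p)))
... | z , z∈p′ , g′≢z = z , proj₁ (delete⁻ (g zero) p z∈p′) , λ where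
  zero    → proj₂ (delete⁻ (g zero) p z∈p′)
  (suc i) → g′≢z i

count-pairs : ∀ {n} (p : Fin n → Bool) →
  ∑[ x < n ] ∑[ x′ < n ] 𝟙 ((toℕ x <ᵇ toℕ x′) ∧ (p x ∧ p x′)) ≡ count p C 2
count-pairs {zero}  p = refl
count-pairs {suc n} p = begin
  ∑[ x′ < n ] 𝟙 (p zero ∧ p (suc x′)) + ∑[ x < n ] ∑[ x′ < n ] 𝟙 ((toℕ x <ᵇ toℕ x′) ∧ (p (suc x) ∧ p (suc x′)))
    ≡⟨ cong₂ _+_ first-row (count-pairs (p ∘ suc)) ⟩
  𝟙 (p zero) * c + c C 2
    ≡⟨ add-p₀ (p zero) ⟩
  (𝟙 (p zero) + c) C 2 ∎
  where
  open ≡-Reasoning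
  c : ℕ
  c = count (p ∘ suc)
  first-row : ∑[ x′ < n ] 𝟙 (p zero ∧ p (suc x′)) ≡ 𝟙 (p zero) * c
  first-row = trans (sum-cong-≗ (λ x′ → 𝟙-∧ (p zero) (p (suc x′))))
                    (sym (*-distribˡ-sum (𝟙 (p zero)) (𝟙 ∘ p ∘ suc)))
  add-p₀ : ∀ b → 𝟙 b * c + c C 2 ≡ (𝟙 b + c) C 2
  add-p₀ true  = trans (cong (_+ c C 2) (trans (+-identityʳ c) (sym (nC1≡n c)))) (nCk+nC[k+1]≡[n+1]C[k+1] c 1)
  add-p₀ false = refl

-- Transversals (systems of distinct representatives)

record Transversal {n k} (P : Fin n → Fin k → Bool) : Set where
  constructor transversal
  field
    pick        : Fin n → Fin k
    pick-inj    : Injective _≡_ _≡_ pick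
    pick-member : ∀ i → T (P i (pick i))

open Transversal

transversal-mono : ∀ {n k} {P Q : Fin n → Fin k → Bool} → (∀ i z → T (P i z) → T (Q i z)) →
  Transversal P → Transversal Q
transversal-mono P⇒Q (transversal g g-inj g∈P) = transversal g g-inj (λ i → P⇒Q i (g i) (g∈P i))

transversal-cons : ∀ {n k} {P : Fin (suc n) → Fin k → Bool} (z : Fin k) → T (P zero z) →
  (τ : Transversal (P ∘ suc)) → (∀ i → pick τ i ≢ z) → Transversal P
transversal-cons {n} {k} {P} z z∈P₀ (transversal g g-inj g∈P) g≢z = transversal g′ g′-inj g′∈P
  where
  g′ : Fin (suc n) → Fin k
  g′ zero    = z
  g′ (suc i) = g i
  g′-inj : Injective _≡_ _≡_ g′
  g′-inj {zero}  {zero}  _ = refl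
  g′-inj {zero}  {suc j} e = ⊥-elim (g≢z j (sym e))
  g′-inj {suc i} {zero}  e = ⊥-elim (g≢z i e)
  g′-inj {suc i} {suc j} e = cong suc (g-inj e)
  g′∈P : ∀ i → T (P i (g′ i))
  g′∈P zero    = z∈P₀
  g′∈P (suc i) = g∈P i

transversal-cons-delete : ∀ {n k} {P : Fin (suc n) → Fin k → Bool} (z : Fin k) → T (P zero z) →
  Transversal (λ i → delete z (P (suc i))) → Transversal P
transversal-cons-delete {P = P} z z∈P₀ τ =
  transversal-cons z z∈P₀ (transversal-mono (λ i _ → proj₁ ∘ delete⁻ z (P (suc i))) τ)
    (λ i → proj₂ (delete⁻ z (P (suc i)) (pick-member τ i)) ∘ sym)

transversal-uniform : ∀ n {k} (P : Fin n → Fin k → Bool) → (∀ i → n ≤ count (P i)) → Transversal P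
transversal-uniform zero    P _     = transversal (λ ()) (λ { {()} }) (λ ())
transversal-uniform (suc n) P n≤|P| =
  let τ = transversal-uniform n (P ∘ suc) (λ i → ≤-trans (n≤1+n n) (n≤|P| (suc i)))
      z , z∈P₀ , τ≢z = fresh (pick τ) (P zero) (n≤|P| zero)
  in transversal-cons z z∈P₀ τ τ≢z

transversal-one-larger : ∀ n {k} (P : Fin (suc n) → Fin k → Bool) (j : Fin (suc n)) →
  suc n ≤ count (P j) → (∀ i → n ≤ count (P i)) → Transversal P
transversal-one-larger n P zero n<|Pⱼ| n≤|P| =
  let τ = transversal-uniform n (P ∘ suc) (n≤|P| ∘ suc)
      z , z∈P₀ , τ≢z = fresh (pick τ) (P zero) n<|Pⱼ|
  in transversal-cons z z∈P₀ τ τ≢z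
transversal-one-larger (suc n) P (suc j) n<|Pⱼ| n≤|P| =
  let z , z∈P₀ = count-witness (P zero) (≤-trans (s≤s z≤n) (n≤|P| zero))
      τ = transversal-one-larger n (λ i → delete z (P (suc i))) j
            (≤-pred (≤-trans n<|Pⱼ| (count≤suc-delete z (P (suc j)))))
            (λ i → ≤-pred (≤-trans (n≤|P| (suc i)) (count≤suc-delete z (P (suc i)))))
  in transversal-cons-delete z z∈P₀ τ

transversal-missing : ∀ n {k} (P : Fin (suc n) → Fin k → Bool) (z : Fin k) (l : Fin n) →
  T (P zero z) → ¬ T (P (suc l) z) → (∀ i → n ≤ count (P i)) → Transversal P
transversal-missing (suc n) P z l z∈P₀ z∉Pₗ n≤|P| =
  transversal-cons-delete z z∈P₀
    (transversal-one-larger n (λ i → delete z (P (suc i))) l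
      (subst (suc n ≤_) (sym (count-delete-absent (P (suc l)) z∉Pₗ)) (n≤|P| (suc l)))
      (λ i → ≤-pred (≤-trans (n≤|P| (suc i)) (count≤suc-delete z (P (suc i))))))

transversal⇒≤count : ∀ {n k} {p : Fin k → Bool} → Transversal {n} (λ _ → p) → n ≤ count p
transversal⇒≤count {zero}          _                          = z≤n
transversal⇒≤count {suc n} {p = p} (transversal g g-inj g∈p) = begin
  suc n                                      ≤⟨ s≤s (transversal⇒≤count τ) ⟩
  suc (count (delete (g zero) p))            ≡⟨ cong (_+ count (delete (g zero) p)) (sym (𝟙-true (g∈p zero))) ⟩
  𝟙 (p (g zero)) + count (delete (g zero) p) ≡⟨ sym (count-delete (g zero) p) ⟩
  count p                                    ∎
  where
  open ≤-Reasoning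
  τ : Transversal {n} (λ _ → delete (g zero) p)
  τ = transversal (g ∘ suc) (suc-injective ∘ g-inj)
        (λ i → delete⁺ (g zero) p (g∈p (suc i)) (0≢1+n ∘ g-inj))

-- Codegrees in a bipartite relation R ⊆ Fin m × Fin k, with t = t′ + 1

module Codegrees {m k : ℕ} (R : Fin m → Fin k → Bool) (t′ : ℕ) where

  t : ℕ
  t = suc t′

  deg : Fin m → ℕ
  deg x = count (R x)

  edgeCount : ℕ
  edgeCount = ∑[ x < m ] deg x

  common : Fin k → Fin k → Fin m → Bool
  common b y x = R x b ∧ R x y

  codeg : Fin k → Fin k → ℕ
  codeg b y = count (common b y)

  Covers : Fin k → Fin k → Fin k → Set
  Covers b y y′ = ∀ x → T (common b y x) → T (R x y′)

  covers? : ∀ b y y′ → Dec (Covers b y y′)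
  covers? b y y′ = all? (λ x → T? (common b y x) →-dec T? (R x y′))

  -- The paper's good set S = N(b) ∩ N(y) of size t; its common neighbourhood N(S) consists of the
  -- y′ covering S.
  GoodPair : Fin k → Fin k → Set
  GoodPair b y = codeg b y ≡ t × t < count (does ∘ covers? b y)

  goodPair? : ∀ b y → Dec (GoodPair b y)
  goodPair? b y = codeg b y ≟ℕ t ×-dec t <? count (does ∘ covers? b y)

  Heavy : Fin k → Fin k → Set
  Heavy b y = b ≢ y × t ≤ codeg b y × ¬ GoodPair b y

  heavy? : ∀ b y → Dec (Heavy b y)
  heavy? b y = ¬? (b ≟ y) ×-dec t ≤? codeg b y ×-dec ¬? (goodPair? b y)

  good< : Fin k → Fin k → ℕ
  good< b y = 𝟙 ((toℕ b <ᵇ toℕ y) ∧ does (goodPair? b y))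

  ∑₂ : (Fin k → Fin k → ℕ) → ℕ
  ∑₂ f = ∑[ b < k ] ∑[ y < k ] f b y

  goodPairs : ℕ
  goodPairs = ∑₂ good<

  -- A copy of B_t: the common edge x₀y₀ and, for each i, the 4-cycle x₀ (ys i) (xs i) y₀.
  record BtPattern : Set where
    field
      x₀     : Fin m
      y₀     : Fin k
      xs     : Fin t → Fin m
      ys     : Fin t → Fin k
      xs-inj : Injective _≡_ _≡_ xs
      ys-inj : Injective _≡_ _≡_ ys
      xs≢x₀  : ∀ i → xs i ≢ x₀
      ys≢y₀  : ∀ i → ys i ≢ y₀
      x₀y₀   : T (R x₀ y₀)
      x₀ys   : ∀ i → T (R x₀ (ys i))
      xsy₀   : ∀ i → T (R (xs i) y₀)
      xsys   : ∀ i → T (R (xs i) (ys i))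

  codeg-delete : ∀ {x b y} → T (R x b) → T (R x y) → codeg b y ≡ suc (count (delete x (common b y)))
  codeg-delete {x} {b} {y} xb xy =
    trans (count-delete x (common b y)) (cong (_+ count (delete x (common b y))) (𝟙-true (xb ∧⁺ xy)))

  star⇒BtPattern : ∀ {x b} (ys : Fin t → Fin k) → T (R x b) → Injective _≡_ _≡_ ys → (∀ i → ys i ≢ b) →
    (∀ i → T (R x (ys i))) → Transversal (λ i → delete x (common b (ys i))) → BtPattern
  star⇒BtPattern {x} {b} ys xb ys-inj ys≢b xys (transversal xs xs-inj xs∈) = record
    { x₀ = x ; y₀ = b ; xs = xs ; ys = ys ; xs-inj = xs-inj ; ys-inj = ys-inj
    ; xs≢x₀ = λ i → proj₂ (delete⁻ x (common b (ys i)) (xs∈ i)) ∘ sym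
    ; ys≢y₀ = ys≢b ; x₀y₀ = xb ; x₀ys = xys
    ; xsy₀ = λ i → proj₁ (to T-∧ (proj₁ (delete⁻ x (common b (ys i)) (xs∈ i))))
    ; xsys = λ i → proj₂ (to T-∧ (proj₁ (delete⁻ x (common b (ys i)) (xs∈ i))))
    }

  -- b, ys 0, …, ys (t − 1) are t + 1 candidates for covering N(b) ∩ N(ys 0), which is not good.
  uncovered-leaf : ∀ {b} (ys : Fin t → Fin k) → Injective _≡_ _≡_ ys → (∀ i → ys i ≢ b) →
    codeg b (ys zero) ≡ t → ¬ GoodPair b (ys zero) →
    ∃₂ λ l z → T (common b (ys zero) z) × ¬ T (R z (ys l))
  uncovered-leaf {b} ys ys-inj ys≢b codeg≡t not-good with all? (covers? b (ys zero) ∘ ys)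
  ... | yes all-cover = ⊥-elim (not-good (codeg≡t , transversal⇒≤count τ))
    where
    τ : Transversal {suc t} (λ _ → does ∘ covers? b (ys zero))
    τ = transversal-cons b (does⁺ (covers? b (ys zero) b) (λ x → proj₁ ∘ to T-∧))
          (transversal ys ys-inj (λ i → does⁺ (covers? b (ys zero) (ys i)) (all-cover i))) ys≢b
  ... | no not-all =
    let l , ¬covers = ¬∀⟶∃¬ t _ (covers? b (ys zero) ∘ ys) not-all
        z , ¬z⇒ = ¬∀⟶∃¬ m _ (λ x → T? (common b (ys zero) x) →-dec T? (R x (ys l))) ¬covers
    in l , z , ¬⇒⇒×¬ ¬z⇒

  -- The leaves xs i are distinct representatives of N(b) ∩ N(ys i) ∖ {x}, sets of size ≥ t − 1.
  heavy-star⇒BtPattern : ∀ {x b} (ys : Fin t → Fin k) → T (R x b) → Injective _≡_ _≡_ ys →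
    (∀ i → T (R x (ys i))) → (∀ i → Heavy b (ys i)) → BtPattern
  heavy-star⇒BtPattern {x} {b} ys xb ys-inj xys heavy = star⇒BtPattern ys xb ys-inj ys≢b xys leaves
    where
    ys≢b : ∀ i → ys i ≢ b
    ys≢b i = proj₁ (heavy i) ∘ sym
    L : Fin t → Fin m → Bool
    L i = delete x (common b (ys i))
    |L|≡ : ∀ i → codeg b (ys i) ≡ suc (count (L i))
    |L|≡ i = codeg-delete xb (xys i)
    t′≤|L| : ∀ i → t′ ≤ count (L i)
    t′≤|L| i = ≤-pred (subst (t ≤_) (|L|≡ i) (proj₁ (proj₂ (heavy i))))
    leaves : Transversal L
    leaves with any? (λ j → t <? codeg b (ys j))
    ... | yes (j , t<codeg) = transversal-one-larger t′ L j (≤-pred (subst (t <_) (|L|≡ j) t<codeg)) t′≤|L|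
    ... | no  none-larger with uncovered-leaf ys ys-inj ys≢b codeg₀≡t (proj₂ (proj₂ (heavy zero)))
      where
      codeg₀≡t : codeg b (ys zero) ≡ t
      codeg₀≡t = ≤-antisym (≮⇒≥ (λ t<codeg → none-larger (zero , t<codeg))) (proj₁ (proj₂ (heavy zero)))
    ... | zero  , z , z∈N , z≁y = ⊥-elim (z≁y (proj₂ (to T-∧ z∈N)))
    ... | suc l , z , z∈N , z≁y =
      transversal-missing t′ L z l (delete⁺ x (common b (ys zero)) z∈N x≢z)
        (z≁y ∘ proj₂ ∘ to T-∧ ∘ proj₁ ∘ delete⁻ x (common b (ys (suc l)))) t′≤|L|
      where
      x≢z : x ≢ z
      x≢z refl = z≁y (xys (suc l))

  heavy-degree≤ : ¬ BtPattern → ∀ {x b} → T (R x b) → count (λ y → R x y ∧ does (heavy? b y)) ≤ t′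
  heavy-degree≤ no-Bt {x} {b} xb with count (λ y → R x y ∧ does (heavy? b y)) ≤? t′
  ... | yes ≤t′ = ≤t′
  ... | no  >t′ = ⊥-elim (no-Bt (heavy-star⇒BtPattern ys xb ys-inj
                                   (λ i → proj₁ (to (T-∧ {R x (ys i)}) (ys∈ i)))
                                   (λ i → does⁻ (heavy? b (ys i)) (proj₂ (to (T-∧ {R x (ys i)}) (ys∈ i))))))
    where
    open Transversal (transversal-uniform t (λ _ y → R x y ∧ does (heavy? b y)) (λ _ → ≰⇒> >t′))
      renaming (pick to ys; pick-inj to ys-inj; pick-member to ys∈)

  ∑deg²≡∑codeg : ∑[ x < m ] (deg x * deg x) ≡ ∑₂ codeg
  ∑deg²≡∑codeg = begin
    ∑[ x < m ] (deg x * deg x)                          ≡⟨ sum-cong-≗ deg² ⟩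
    ∑[ x < m ] ∑[ b < k ] ∑[ y < k ] 𝟙 (common b y x)   ≡⟨ ∑-comm (λ x b → ∑[ y < k ] 𝟙 (common b y x)) ⟩
    ∑[ b < k ] ∑[ x < m ] ∑[ y < k ] 𝟙 (common b y x)   ≡⟨ sum-cong-≗ (λ b → ∑-comm (λ x y → 𝟙 (common b y x))) ⟩
    ∑₂ codeg                                            ∎
    where
    open ≡-Reasoning
    deg² : ∀ x → deg x * deg x ≡ ∑[ b < k ] ∑[ y < k ] 𝟙 (common b y x)
    deg² x = begin
      deg x * deg x                                  ≡⟨ *-distribʳ-sum (deg x) (𝟙 ∘ R x) ⟩
      ∑[ b < k ] (𝟙 (R x b) * deg x)                 ≡⟨ sum-cong-≗ (λ b → *-distribˡ-sum (𝟙 (R x b)) (𝟙 ∘ R x)) ⟩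
      ∑[ b < k ] ∑[ y < k ] (𝟙 (R x b) * 𝟙 (R x y))  ≡⟨ sum-cong-≗ (λ b → sum-cong-≗ (λ y → sym (𝟙-∧ (R x b) (R x y)))) ⟩
      ∑[ b < k ] ∑[ y < k ] 𝟙 (common b y x)         ∎

  codeg-sym : ∀ b y → codeg b y ≡ codeg y b
  codeg-sym b y = sum-cong-≗ (λ x → cong 𝟙 (∧-comm (R x b) (R x y)))

  GoodPair-sym : ∀ {b y} → GoodPair b y → GoodPair y b
  GoodPair-sym {b} {y} (codeg≡t , t<|covers|) =
    trans (sym (codeg-sym b y)) codeg≡t ,
    subst (t <_) (sum-cong-≗ (λ y′ → cong 𝟙 (does-⇔ (mk⇔ swap swap) (covers? b y y′) (covers? y b y′)))) t<|covers|
    where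
    swap : ∀ {b y y′} → Covers b y y′ → Covers y b y′
    swap {b} {y} cov x x∈N = cov x (subst T (∧-comm (R x y) (R x b)) x∈N)

  good<≡1 : ∀ {b y} → toℕ b < toℕ y → GoodPair b y → good< b y ≡ 1
  good<≡1 {b} {y} b<y good = 𝟙-true (<⇒<ᵇ b<y ∧⁺ does⁺ (goodPair? b y) good)

  off-diagonal-codeg≤ : ∀ {b y} → b ≢ y →
    codeg b y ≤ t′ + (good< b y + good< y b) + 𝟙 (does (heavy? b y)) * codeg b y
  off-diagonal-codeg≤ {b} {y} b≢y = by-cases (codeg b y ≤? t′) (goodPair? b y)
    where
    open ≤-Reasoning
    H : ℕ
    H = 𝟙 (does (heavy? b y)) * codeg b y
    counted-once : GoodPair b y → 1 ≤ good< b y + good< y b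
    counted-once good with <-cmp (toℕ b) (toℕ y)
    ... | tri< b<y _ _ = ≤-trans (≤-reflexive (sym (good<≡1 b<y good))) (m≤m+n _ _)
    ... | tri≈ _ b≡y _ = ⊥-elim (b≢y (toℕ-injective b≡y))
    ... | tri> _ _ y<b = ≤-trans (≤-reflexive (sym (good<≡1 y<b (GoodPair-sym good)))) (m≤n+m _ _)
    by-cases : Dec (codeg b y ≤ t′) → Dec (GoodPair b y) → codeg b y ≤ t′ + (good< b y + good< y b) + H
    by-cases (yes ≤t′) _ = ≤-trans ≤t′ (≤-trans (m≤m+n t′ _) (m≤m+n _ H))
    by-cases (no >t′) (no not-good) = begin
      codeg b y      ≡⟨ sym (+-identityʳ _) ⟩
      1 * codeg b y  ≡⟨ cong (_* codeg b y) (sym (𝟙-true (does⁺ (heavy? b y) (b≢y , ≰⇒> >t′ , not-good)))) ⟩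
      H              ≤⟨ m≤n+m H _ ⟩
      _ + H          ∎
    by-cases (no _) (yes good) = begin
      codeg b y                         ≡⟨ trans (proj₁ good) (+-comm 1 t′) ⟩
      t′ + 1                            ≤⟨ +-monoʳ-≤ t′ (counted-once good) ⟩
      t′ + (good< b y + good< y b)      ≤⟨ m≤m+n _ H ⟩
      t′ + (good< b y + good< y b) + H  ∎

  diagonal : Fin k → Fin k → ℕ
  diagonal b y = 𝟙 (does (b ≟ y)) * codeg b y

  excess : Fin k → Fin k → ℕ
  excess b y = 𝟙 (does (heavy? b y)) * codeg b y

  codeg≤ : ∀ b y → codeg b y ≤ diagonal b y + t′ + (good< b y + good< y b) + excess b y
  codeg≤ b y = by-cases (b ≟ y)
    where
    G : ℕ
    G = good< b y + good< y b
    -- Pattern matching on b ≟ y directly would also rewrite the copy hidden inside heavy? b y.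
    by-cases : Dec (b ≡ y) → codeg b y ≤ diagonal b y + t′ + G + excess b y
    by-cases (yes b≡y) = subst (λ v → codeg b y ≤ 𝟙 v * codeg b y + t′ + G + excess b y) (sym (dec-true (b ≟ y) b≡y))
      (≤-trans (m≤m+n (codeg b y) 0) (≤-trans (m≤m+n _ t′) (≤-trans (m≤m+n _ G) (m≤m+n _ (excess b y)))))
    by-cases (no b≢y) = subst (λ v → codeg b y ≤ 𝟙 v * codeg b y + t′ + G + excess b y) (sym (dec-false (b ≟ y) b≢y))
      (off-diagonal-codeg≤ b≢y)

  ∑₂-distrib-+ : (f g : Fin k → Fin k → ℕ) → ∑₂ (λ b y → f b y + g b y) ≡ ∑₂ f + ∑₂ g
  ∑₂-distrib-+ f g =
    trans (sum-cong-≗ (λ b → ∑-distrib-+ (f b) (g b))) (∑-distrib-+ (λ b → ∑[ y < k ] f b y) (λ b → ∑[ y < k ] g b y))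

  ∑-diagonal : ∑₂ diagonal ≡ edgeCount
  ∑-diagonal = begin
    ∑₂ diagonal                      ≡⟨ sum-cong-≗ (λ b → ∑-δ b (codeg b)) ⟩
    ∑[ b < k ] codeg b b             ≡⟨ sum-cong-≗ (λ b → sum-cong-≗ (λ x → cong 𝟙 (∧-idem (R x b)))) ⟩
    ∑[ b < k ] ∑[ x < m ] 𝟙 (R x b)  ≡⟨ ∑-comm (λ b x → 𝟙 (R x b)) ⟩
    edgeCount                        ∎
    where open ≡-Reasoning

  ∑-excess≤ : ¬ BtPattern → ∑₂ excess ≤ t′ * edgeCount
  ∑-excess≤ no-Bt = begin
    ∑₂ excess
      ≡⟨ sum-cong-≗ (λ b → sum-cong-≗ (λ y → *-distribˡ-sum (h b y) (𝟙 ∘ common b y))) ⟩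
    ∑[ b < k ] ∑[ y < k ] ∑[ x < m ] (h b y * 𝟙 (common b y x))
      ≡⟨ sum-cong-≗ (λ b → sum-cong-≗ (λ y → sum-cong-≗ (λ x → regroup (R x b) (R x y) _))) ⟩
    ∑[ b < k ] ∑[ y < k ] ∑[ x < m ] (𝟙 (R x b) * heavy-nbr x b y)
      ≡⟨ sum-cong-≗ (λ b → ∑-comm (λ y x → 𝟙 (R x b) * heavy-nbr x b y)) ⟩
    ∑[ b < k ] ∑[ x < m ] ∑[ y < k ] (𝟙 (R x b) * heavy-nbr x b y)
      ≡⟨ ∑-comm (λ b x → ∑[ y < k ] (𝟙 (R x b) * heavy-nbr x b y)) ⟩
    ∑[ x < m ] ∑[ b < k ] ∑[ y < k ] (𝟙 (R x b) * heavy-nbr x b y)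
      ≡⟨ sum-cong-≗ (λ x → sum-cong-≗ (λ b → sym (*-distribˡ-sum (𝟙 (R x b)) (heavy-nbr x b)))) ⟩
    ∑[ x < m ] ∑[ b < k ] (𝟙 (R x b) * count (λ y → R x y ∧ does (heavy? b y)))
      ≤⟨ ∑-mono-≤ (λ x → ∑-mono-≤ (λ b → 𝟙-*-heavy-degree≤ x b)) ⟩
    ∑[ x < m ] ∑[ b < k ] (𝟙 (R x b) * t′)
      ≡⟨ sum-cong-≗ (λ x → sym (*-distribʳ-sum t′ (𝟙 ∘ R x))) ⟩
    ∑[ x < m ] (deg x * t′)
      ≡⟨ sym (*-distribʳ-sum t′ deg) ⟩
    edgeCount * t′
      ≡⟨ *-comm edgeCount t′ ⟩
    t′ * edgeCount ∎
    where
    open ≤-Reasoning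
    h : Fin k → Fin k → ℕ
    h b y = 𝟙 (does (heavy? b y))
    heavy-nbr : Fin m → Fin k → Fin k → ℕ
    heavy-nbr x b y = 𝟙 (R x y ∧ does (heavy? b y))
    regroup : ∀ a c d → 𝟙 d * 𝟙 (a ∧ c) ≡ 𝟙 a * 𝟙 (c ∧ d)
    regroup false c d = *-zeroʳ (𝟙 d)
    regroup true  c d = trans (*-comm (𝟙 d) (𝟙 c)) (trans (sym (𝟙-∧ c d)) (sym (+-identityʳ _)))
    𝟙-*-heavy-degree≤ : ∀ x b → 𝟙 (R x b) * count (λ y → R x y ∧ does (heavy? b y)) ≤ 𝟙 (R x b) * t′
    𝟙-*-heavy-degree≤ x b with R x b in xb
    ... | true  = *-monoʳ-≤ 1 (heavy-degree≤ no-Bt (subst T (sym xb) tt))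
    ... | false = z≤n

  ∑deg²≤ : ¬ BtPattern → ∑[ x < m ] (deg x * deg x) ≤ t * edgeCount + t′ * (k * k) + 2 * goodPairs
  ∑deg²≤ no-Bt = begin
    ∑[ x < m ] (deg x * deg x)
      ≡⟨ ∑deg²≡∑codeg ⟩
    ∑₂ codeg
      ≤⟨ ∑-mono-≤ (λ b → ∑-mono-≤ (codeg≤ b)) ⟩
    ∑₂ (λ b y → diagonal b y + t′ + (good< b y + good< y b) + excess b y)
      ≡⟨ trans (∑₂-distrib-+ _ excess) (cong (_+ ∑₂ excess) (trans (∑₂-distrib-+ _ _)
           (cong₂ _+_ (∑₂-distrib-+ diagonal (λ _ _ → t′)) (∑₂-distrib-+ good< (λ b y → good< y b))))) ⟩
    ∑₂ diagonal + ∑₂ (λ _ _ → t′) + (goodPairs + ∑₂ (λ b y → good< y b)) + ∑₂ excess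
      ≤⟨ +-mono-≤ (≤-reflexive (cong₂ _+_ (cong₂ _+_ ∑-diagonal ∑₂-const)
                                          (cong (_+_ goodPairs) (∑-comm (λ b y → good< y b)))))
                  (∑-excess≤ no-Bt) ⟩
    edgeCount + k * (k * t′) + (goodPairs + goodPairs) + t′ * edgeCount
      ≡⟨ solve 4 (λ e k g s → e :+ k :* (k :* s) :+ (g :+ g) :+ s :* e := (con 1 :+ s) :* e :+ s :* (k :* k) :+ con 2 :* g)
           refl edgeCount k goodPairs t′ ⟩
    t * edgeCount + t′ * (k * k) + 2 * goodPairs ∎
    where
    open ≤-Reasoning
    open +-*-Solver using (solve; _:+_; _:*_; _:=_; con)
    ∑₂-const : ∑₂ (λ _ _ → t′) ≡ k * (k * t′)
    ∑₂-const = trans (sum-cong-≗ {n = k} (λ _ → ∑-const k t′)) (∑-const k (k * t′))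

length-filter : ∀ {a p} {A : Set a} {P : Pred A p} (P? : Decidable P) (xs : List A) →
  length (filter P? xs) ≡ List.sum (map (𝟙 ∘ does ∘ P?) xs)
length-filter P? []       = refl
length-filter P? (x ∷ xs) with does (P? x)
... | true  = cong suc (length-filter P? xs)
... | false = length-filter P? xs

sum-filterᵇ : ∀ {A : Set} (q : A → Bool) (f : A → ℕ) (xs : List A) →
  List.sum (map f (filterᵇ q xs)) ≡ List.sum (map (λ x → 𝟙 (q x) * f x) xs)
sum-filterᵇ q f []       = refl
sum-filterᵇ q f (x ∷ xs) with q x
... | true  = cong₂ _+_ (sym (+-identityʳ (f x))) (sum-filterᵇ q f xs)
... | false = sum-filterᵇ q f xs

sum-map-++ : ∀ {A : Set} (f : A → ℕ) (xs ys : List A) →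
  List.sum (map f (xs ++ ys)) ≡ List.sum (map f xs) + List.sum (map f ys)
sum-map-++ f xs ys = trans (cong List.sum (map-++ f xs ys)) (sum-++ (map f xs) (map f ys))

sum-map-tabulate : ∀ {A : Set} n (f : A → ℕ) (g : Fin n → A) →
  List.sum (map f (tabulate g)) ≡ ∑[ i < n ] f (g i)
sum-map-tabulate zero    f g = refl
sum-map-tabulate (suc n) f g = cong (_+_ (f (g zero))) (sum-map-tabulate n f (g ∘ suc))

sum-cartesianProduct : ∀ {A B : Set} (f : A × B → ℕ) (xs : List A) (ys : List B) →
  List.sum (map f (cartesianProduct xs ys)) ≡ List.sum (map (λ x → List.sum (map (λ y → f (x , y)) ys)) xs)
sum-cartesianProduct f []       ys = refl
sum-cartesianProduct f (x ∷ xs) ys =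
  trans (sum-map-++ f (map (x ,_) ys) (cartesianProduct xs ys))
        (cong₂ _+_ (cong List.sum (sym (map-∘ ys))) (sum-cartesianProduct f xs ys))

sum-grid : ∀ {a b} (f : Fin a × Fin b → ℕ) →
  List.sum (map f (cartesianProduct (allFin a) (allFin b))) ≡ ∑[ i < a ] ∑[ j < b ] f (i , j)
sum-grid {a} {b} f =
  trans (sum-cartesianProduct f (allFin a) (allFin b))
        (trans (sum-map-tabulate a _ id) (sum-cong-≗ (λ i → sum-map-tabulate b (λ j → f (i , j)) id)))

sum-vertices : ∀ {n₁ n₂} (h : Vtx n₁ n₂ → ℕ) →
  List.sum (map h (vertices n₁ n₂)) ≡ ∑[ a < n₁ ] h (inj₁ a) + ∑[ b < n₂ ] h (inj₂ b)
sum-vertices {n₁} {n₂} h =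
  trans (sum-map-++ h (map inj₁ (allFin n₁)) (map inj₂ (allFin n₂)))
        (cong₂ _+_ (trans (cong List.sum (sym (map-∘ (allFin n₁)))) (sum-map-tabulate n₁ (h ∘ inj₁) id))
                   (trans (cong List.sum (sym (map-∘ (allFin n₂)))) (sum-map-tabulate n₂ (h ∘ inj₂) id)))

-- The graph seen from part i: V_i plays the role of X and the other part that of Y

other : Part → Part
other one = two
other two = one

ι : ∀ {n₁ n₂} (i : Part) → Fin (partSize n₁ n₂ i) → Vtx n₁ n₂
ι one = inj₁
ι two = inj₂

ι-injective : ∀ {n₁ n₂} (i : Part) {x x′ : Fin (partSize n₁ n₂ i)} → ι {n₁} {n₂} i x ≡ ι i x′ → x ≡ x′
ι-injective one = inj₁-injective
ι-injective two = inj₂-injective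

ι-disjoint : ∀ {n₁ n₂} (i : Part) {x : Fin (partSize n₁ n₂ i)} {y : Fin (partSize n₁ n₂ (other i))} →
  ι {n₁} {n₂} i x ≢ ι (other i) y
ι-disjoint one ()
ι-disjoint two ()

vertex-side-elim : ∀ {n₁ n₂} (i : Part) {P : Vtx n₁ n₂ → Set} →
  (∀ x → P (ι i x)) → (∀ y → P (ι (other i) y)) → ∀ v → P v
vertex-side-elim one on-i on-other (inj₁ a) = on-i a
vertex-side-elim one on-i on-other (inj₂ b) = on-other b
vertex-side-elim two on-i on-other (inj₁ a) = on-other a
vertex-side-elim two on-i on-other (inj₂ b) = on-i b

sideRel : ∀ {n₁ n₂} → BipGraph n₁ n₂ → (i : Part) →
  Fin (partSize n₁ n₂ i) → Fin (partSize n₁ n₂ (other i)) → Bool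
sideRel G i x y = adj G (ι i x) (ι (other i) y)

adj-sym : ∀ {n₁ n₂} (G : BipGraph n₁ n₂) (u v : Vtx n₁ n₂) → adj G u v ≡ adj G v u
adj-sym G (inj₁ _) (inj₁ _) = refl
adj-sym G (inj₁ _) (inj₂ _) = refl
adj-sym G (inj₂ _) (inj₁ _) = refl
adj-sym G (inj₂ _) (inj₂ _) = refl

adj-same-side : ∀ {n₁ n₂} (G : BipGraph n₁ n₂) (i : Part) (x x′ : Fin (partSize n₁ n₂ i)) →
  adj G (ι i x) (ι i x′) ≡ false
adj-same-side G one x x′ = refl
adj-same-side G two x x′ = refl

inPart-ι : ∀ {n₁ n₂} (i : Part) (x : Fin (partSize n₁ n₂ i)) → inPart i (ι {n₁} {n₂} i x) ≡ true
inPart-ι one x = refl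
inPart-ι two x = refl

inPart-ι-other : ∀ {n₁ n₂} (i : Part) (y : Fin (partSize n₁ n₂ (other i))) →
  inPart i (ι {n₁} {n₂} (other i) y) ≡ false
inPart-ι-other one y = refl
inPart-ι-other two y = refl

sum-vertices-side : ∀ {n₁ n₂} (i : Part) (h : Vtx n₁ n₂ → ℕ) →
  List.sum (map h (vertices n₁ n₂)) ≡
  ∑[ x < partSize n₁ n₂ i ] h (ι i x) + ∑[ y < partSize n₁ n₂ (other i) ] h (ι (other i) y)
sum-vertices-side one h = sum-vertices h
sum-vertices-side two h = trans (sum-vertices h) (+-comm (∑[ a < _ ] h (inj₁ a)) (∑[ b < _ ] h (inj₂ b)))

countV-side : ∀ {n₁ n₂} (i : Part) (p : Vtx n₁ n₂ → Bool) →
  countV p ≡ count (p ∘ ι i) + count (p ∘ ι (other i))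
countV-side {n₁} {n₂} i p = trans (length-filter (T? ∘ p) (vertices n₁ n₂)) (sum-vertices-side i (𝟙 ∘ p))

degree-side : ∀ {n₁ n₂} (G : BipGraph n₁ n₂) (i : Part) (x : Fin (partSize n₁ n₂ i)) →
  degree G (ι i x) ≡ count (sideRel G i x)
degree-side {n₁} {n₂} G i x = begin
  degree G (ι i x)                                     ≡⟨ countV-side i (adj G (ι i x)) ⟩
  count (adj G (ι i x) ∘ ι i) + count (sideRel G i x)  ≡⟨ cong (_+ count (sideRel G i x)) no-same-side ⟩
  count (sideRel G i x)                                ∎
  where
  open ≡-Reasoning
  no-same-side : count (adj G (ι i x) ∘ ι i) ≡ 0
  no-same-side = trans (sum-cong-≗ (λ x′ → cong 𝟙 (adj-same-side G i x x′))) (sum-replicate-zero (partSize n₁ n₂ i))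

sumDegSq-side : ∀ {n₁ n₂} (G : BipGraph n₁ n₂) (i : Part) →
  sumDegSq G i ≡ ∑[ x < partSize n₁ n₂ i ] (count (sideRel G i x) * count (sideRel G i x))
sumDegSq-side {n₁} {n₂} G i = begin
  sumDegSq G i
    ≡⟨ sum-filterᵇ (inPart i) (λ u → degree G u ^ 2) (vertices n₁ n₂) ⟩
  List.sum (map (λ u → 𝟙 (inPart i u) * degree G u ^ 2) (vertices n₁ n₂))
    ≡⟨ sum-vertices-side i _ ⟩
  ∑[ x < partSize n₁ n₂ i ] (𝟙 (inPart i (ι i x)) * degree G (ι i x) ^ 2)
    + ∑[ y < partSize n₁ n₂ (other i) ] (𝟙 (inPart i (ι (other i) y)) * degree G (ι (other i) y) ^ 2)
    ≡⟨ cong₂ _+_ (sum-cong-≗ on-i) (trans (sum-cong-≗ on-other) (sum-replicate-zero (partSize n₁ n₂ (other i)))) ⟩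
  ∑[ x < partSize n₁ n₂ i ] (count (sideRel G i x) * count (sideRel G i x)) + 0
    ≡⟨ +-identityʳ _ ⟩
  ∑[ x < partSize n₁ n₂ i ] (count (sideRel G i x) * count (sideRel G i x)) ∎
  where
  open ≡-Reasoning
  on-i : ∀ x → 𝟙 (inPart i (ι i x)) * degree G (ι i x) ^ 2 ≡ count (sideRel G i x) * count (sideRel G i x)
  on-i x rewrite inPart-ι {n₁} {n₂} i x | degree-side G i x =
    trans (+-identityʳ _) (cong (count (sideRel G i x) *_) (*-identityʳ _))
  on-other : ∀ y → 𝟙 (inPart i (ι (other i) y)) * degree G (ι (other i) y) ^ 2 ≡ 0
  on-other y rewrite inPart-ι-other {n₁} {n₂} i y = refl

edges-grid : ∀ {n₁ n₂} (G : BipGraph n₁ n₂) → edges G ≡ ∑[ a < n₁ ] ∑[ b < n₂ ] 𝟙 (G a b)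
edges-grid {n₁} {n₂} G =
  trans (length-filter (T? ∘ λ p → G (proj₁ p) (proj₂ p)) (cartesianProduct (allFin n₁) (allFin n₂)))
        (sum-grid (λ p → 𝟙 (G (proj₁ p) (proj₂ p))))

edges-side : ∀ {n₁ n₂} (G : BipGraph n₁ n₂) (i : Part) →
  edges G ≡ ∑[ x < partSize n₁ n₂ i ] count (sideRel G i x)
edges-side G one = edges-grid G
edges-side G two = trans (edges-grid G) (∑-comm (λ a b → 𝟙 (G a b)))

module BtPatternEmbedding {n₁ n₂ : ℕ} (t′ : ℕ) (G : BipGraph n₁ n₂) (i : Part)
                          (B : Codegrees.BtPattern (sideRel G i) t′) where

  open Codegrees.BtPattern B

  o : Part
  o = other i

  embed : BVtx (suc t′) → Vtx n₁ n₂
  embed (false , nothing) = ι i x₀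
  embed (true  , nothing) = ι o y₀
  embed (false , just l)  = ι o (ys l)
  embed (true  , just l)  = ι i (xs l)

  embed-inj : Injective _≡_ _≡_ embed
  embed-inj {false , nothing} {false , nothing} _ = refl
  embed-inj {false , nothing} {true  , nothing} e = ⊥-elim (ι-disjoint i e)
  embed-inj {false , nothing} {false , just l}  e = ⊥-elim (ι-disjoint i e)
  embed-inj {false , nothing} {true  , just l}  e = ⊥-elim (xs≢x₀ l (sym (ι-injective i e)))
  embed-inj {true  , nothing} {false , nothing} e = ⊥-elim (ι-disjoint i (sym e))
  embed-inj {true  , nothing} {true  , nothing} _ = refl
  embed-inj {true  , nothing} {false , just l}  e = ⊥-elim (ys≢y₀ l (sym (ι-injective o e)))
  embed-inj {true  , nothing} {true  , just l}  e = ⊥-elim (ι-disjoint i (sym e))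
  embed-inj {false , just l}  {false , nothing} e = ⊥-elim (ι-disjoint i (sym e))
  embed-inj {false , just l}  {true  , nothing} e = ⊥-elim (ys≢y₀ l (ι-injective o e))
  embed-inj {false , just l}  {false , just l′} e = cong (λ z → false , just z) (ys-inj (ι-injective o e))
  embed-inj {false , just l}  {true  , just l′} e = ⊥-elim (ι-disjoint i (sym e))
  embed-inj {true  , just l}  {false , nothing} e = ⊥-elim (xs≢x₀ l (ι-injective i e))
  embed-inj {true  , just l}  {true  , nothing} e = ⊥-elim (ι-disjoint i e)
  embed-inj {true  , just l}  {false , just l′} e = ⊥-elim (ι-disjoint i e)
  embed-inj {true  , just l}  {true  , just l′} e = cong (λ z → true , just z) (xs-inj (ι-injective i e))

  flip : ∀ x y → T (sideRel G i x y) → T (adj G (ι o y) (ι i x))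
  flip x y = subst T (adj-sym G (ι i x) (ι o y))

  embed-adj : ∀ p q → BAdj p q → T (adj G (embed p) (embed q))
  embed-adj (false , nothing) (false , just l)  (inj₁ _)          = x₀ys l
  embed-adj (false , just l)  (false , nothing) (inj₁ _)          = flip x₀ (ys l) (x₀ys l)
  embed-adj (true  , nothing) (true  , just l)  (inj₁ _)          = flip (xs l) y₀ (xsy₀ l)
  embed-adj (true  , just l)  (true  , nothing) (inj₁ _)          = xsy₀ l
  embed-adj (false , nothing) (true  , nothing) (inj₂ _)          = x₀y₀
  embed-adj (true  , nothing) (false , nothing) (inj₂ _)          = flip x₀ y₀ x₀y₀
  embed-adj (false , just l)  (true  , just .l) (inj₂ (refl , _)) = flip (xs l) (ys l) (xsys l)
  embed-adj (true  , just l)  (false , just .l) (inj₂ (refl , _)) = xsys l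
  embed-adj (_     , nothing) (_     , nothing) (inj₁ (_ , ()))
  embed-adj (_     , just _)  (_     , just _)  (inj₁ (_ , ()))
  embed-adj (false , _)       (true  , _)       (inj₁ (() , _))
  embed-adj (true  , _)       (false , _)       (inj₁ (() , _))
  embed-adj (false , _)       (false , _)       (inj₂ (_ , s≢s))  = ⊥-elim (s≢s refl)
  embed-adj (true  , _)       (true  , _)       (inj₂ (_ , s≢s))  = ⊥-elim (s≢s refl)
  embed-adj (_     , nothing) (_     , just _)  (inj₂ (() , _))
  embed-adj (_     , just _)  (_     , nothing) (inj₂ (() , _))

BtFree⇒¬BtPattern : ∀ {n₁ n₂} (t′ : ℕ) (G : BipGraph n₁ n₂) (i : Part) →
  BtFree (suc t′) G → ¬ Codegrees.BtPattern (sideRel G i) t′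
BtFree⇒¬BtPattern t′ G i free B = free (embed , embed-inj , embed-adj)
  where open BtPatternEmbedding t′ G i B

-- Counting 4-cycles

onSide : ∀ {n₁ n₂} (i : Part) → Subset (partSize n₁ n₂ i) → VSet n₁ n₂
onSide one s = s , ⊥
onSide two s = ⊥ , s

size-onSide : ∀ {n₁ n₂} (i : Part) (s : Subset (partSize n₁ n₂ i)) → size (onSide {n₁} {n₂} i s) ≡ ∣ s ∣
size-onSide {n₁} {n₂} one s = trans (cong (_+_ ∣ s ∣) (∣⊥∣≡0 n₂)) (+-identityʳ ∣ s ∣)
size-onSide {n₁} {n₂} two s = cong (_+ ∣ s ∣) (∣⊥∣≡0 n₁)

memᵇ-onSide : ∀ {n₁ n₂} (i : Part) (s : Subset (partSize n₁ n₂ i)) x →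
  memᵇ (onSide {n₁} {n₂} i s) (ι i x) ≡ lookup s x
memᵇ-onSide one s x = refl
memᵇ-onSide two s x = refl

memᵇ-onSide-other : ∀ {n₁ n₂} (i : Part) (s : Subset (partSize n₁ n₂ i)) y →
  memᵇ (onSide {n₁} {n₂} i s) (ι (other i) y) ≡ false
memᵇ-onSide-other one s y = lookup-replicate y false
memᵇ-onSide-other two s y = lookup-replicate y false

∣tabulate∣≡count : ∀ {n} (p : Fin n → Bool) → ∣ Vec.tabulate p ∣ ≡ count p
∣tabulate∣≡count {zero}  p = refl
∣tabulate∣≡count {suc n} p with p zero
... | true  = cong suc (∣tabulate∣≡count (p ∘ suc))
... | false = ∣tabulate∣≡count (p ∘ suc)

c4At : ∀ {n₁ n₂} (i : Part) (x x′ : Fin (partSize n₁ n₂ i)) (y y′ : Fin (partSize n₁ n₂ (other i))) →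
  C4Cand n₁ n₂
c4At one x x′ y y′ = (x , x′) , (y , y′)
c4At two x x′ y y′ = (y , y′) , (x , x′)

isC4-c4At : ∀ {n₁ n₂} (G : BipGraph n₁ n₂) (i : Part) x x′ y y′ →
  T (toℕ x <ᵇ toℕ x′) → T (toℕ y <ᵇ toℕ y′) →
  T (sideRel G i x y) → T (sideRel G i x y′) → T (sideRel G i x′ y) → T (sideRel G i x′ y′) →
  T (isC4ᵇ G (c4At i x x′ y y′))
isC4-c4At G one x x′ y y′ x<x′ y<y′ xy xy′ x′y x′y′ = x<x′ ∧⁺ y<y′ ∧⁺ xy ∧⁺ xy′ ∧⁺ x′y ∧⁺ x′y′
isC4-c4At G two x x′ y y′ x<x′ y<y′ xy xy′ x′y x′y′ = y<y′ ∧⁺ x<x′ ∧⁺ xy ∧⁺ x′y ∧⁺ xy′ ∧⁺ x′y′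

c4verts-covered : ∀ {n₁ n₂} (i : Part) (S : VSet n₁ n₂) x x′ y y′ →
  T (memᵇ S (ι i x)) → T (memᵇ S (ι i x′)) →
  T (all (λ v → not (inPart i v) ∨ memᵇ S v) (c4verts (c4At i x x′ y y′)))
c4verts-covered one S x x′ y y′ x∈S x′∈S = x∈S ∧⁺ x′∈S ∧⁺ tt ∧⁺ tt ∧⁺ tt
c4verts-covered two S x x′ y y′ x∈S x′∈S = tt ∧⁺ tt ∧⁺ x∈S ∧⁺ x′∈S ∧⁺ tt

sum-C4Cand : ∀ {n₁ n₂} (i : Part) (F : C4Cand n₁ n₂ → ℕ) →
  List.sum (map F (cartesianProduct (cartesianProduct (allFin n₁) (allFin n₁))
                                    (cartesianProduct (allFin n₂) (allFin n₂)))) ≡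
  ∑[ y < partSize n₁ n₂ (other i) ] ∑[ y′ < partSize n₁ n₂ (other i) ]
  ∑[ x < partSize n₁ n₂ i ] ∑[ x′ < partSize n₁ n₂ i ] F (c4At i x x′ y y′)
sum-C4Cand {n₁} {n₂} i F = begin
  List.sum (map F (cartesianProduct pairs₁ pairs₂))
    ≡⟨ sum-cartesianProduct F pairs₁ pairs₂ ⟩
  List.sum (map (λ p → List.sum (map (λ q → F (p , q)) pairs₂)) pairs₁)
    ≡⟨ cong List.sum (map-cong (λ p → sum-grid (λ q → F (p , q))) pairs₁) ⟩
  List.sum (map (λ p → ∑[ b < n₂ ] ∑[ b′ < n₂ ] F (p , (b , b′))) pairs₁)
    ≡⟨ sum-grid (λ p → ∑[ b < n₂ ] ∑[ b′ < n₂ ] F (p , (b , b′))) ⟩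
  ∑[ a < n₁ ] ∑[ a′ < n₁ ] ∑[ b < n₂ ] ∑[ b′ < n₂ ] F ((a , a′) , (b , b′))
    ≡⟨ by-side i ⟩
  ∑[ y < partSize n₁ n₂ (other i) ] ∑[ y′ < partSize n₁ n₂ (other i) ]
  ∑[ x < partSize n₁ n₂ i ] ∑[ x′ < partSize n₁ n₂ i ] F (c4At i x x′ y y′) ∎
  where
  open ≡-Reasoning
  pairs₁ : List (Fin n₁ × Fin n₁)
  pairs₁ = cartesianProduct (allFin n₁) (allFin n₁)
  pairs₂ : List (Fin n₂ × Fin n₂)
  pairs₂ = cartesianProduct (allFin n₂) (allFin n₂)
  by-side : ∀ i → ∑[ a < n₁ ] ∑[ a′ < n₁ ] ∑[ b < n₂ ] ∑[ b′ < n₂ ] F ((a , a′) , (b , b′)) ≡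
    ∑[ y < partSize n₁ n₂ (other i) ] ∑[ y′ < partSize n₁ n₂ (other i) ]
    ∑[ x < partSize n₁ n₂ i ] ∑[ x′ < partSize n₁ n₂ i ] F (c4At i x x′ y y′)
  by-side one = ∑₄-swap (λ a a′ b b′ → F ((a , a′) , (b , b′)))
  by-side two = refl

module CountC4 {n₁ n₂ : ℕ} (t′ : ℕ) (G : BipGraph n₁ n₂) (i : Part) where

  R : Fin (partSize n₁ n₂ i) → Fin (partSize n₁ n₂ (other i)) → Bool
  R = sideRel G i

  open Codegrees R t′

  m k : ℕ
  m = partSize n₁ n₂ i
  k = partSize n₁ n₂ (other i)

  counted : C4Cand n₁ n₂ → Bool
  counted C = isC4ᵇ G C ∧ does (hasGoodSet? t G i C)

  N-C4≡ : N-C4 t G i ≡ ∑[ y < k ] ∑[ y′ < k ] ∑[ x < m ] ∑[ x′ < m ] 𝟙 (counted (c4At i x x′ y y′))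
  N-C4≡ = begin
    N-C4 t G i
      ≡⟨ length-filter (hasGoodSet? t G i) (c4copies G) ⟩
    List.sum (map (𝟙 ∘ does ∘ hasGoodSet? t G i) (c4copies G))
      ≡⟨ sum-filterᵇ (isC4ᵇ G) (𝟙 ∘ does ∘ hasGoodSet? t G i) candidates ⟩
    List.sum (map (λ C → 𝟙 (isC4ᵇ G C) * 𝟙 (does (hasGoodSet? t G i C))) candidates)
      ≡⟨ cong List.sum (map-cong (λ C → sym (𝟙-∧ (isC4ᵇ G C) (does (hasGoodSet? t G i C)))) candidates) ⟩
    List.sum (map (𝟙 ∘ counted) candidates)
      ≡⟨ sum-C4Cand i (𝟙 ∘ counted) ⟩
    ∑[ y < k ] ∑[ y′ < k ] ∑[ x < m ] ∑[ x′ < m ] 𝟙 (counted (c4At i x x′ y y′)) ∎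
    where
    open ≡-Reasoning
    candidates : List (C4Cand n₁ n₂)
    candidates = cartesianProduct (cartesianProduct (allFin n₁) (allFin n₁))
                                  (cartesianProduct (allFin n₂) (allFin n₂))

  goodSet : Fin k → Fin k → VSet n₁ n₂
  goodSet y y′ = onSide i (Vec.tabulate (common y y′))

  goodSet-member : ∀ {y y′ z} → T (common y y′ z) → T (memᵇ (goodSet y y′) (ι i z))
  goodSet-member {y} {y′} {z} =
    subst T (sym (trans (memᵇ-onSide i (Vec.tabulate (common y y′)) z) (lookup∘tabulate (common y y′) z)))

  size-goodSet : ∀ y y′ → size (goodSet y y′) ≡ codeg y y′
  size-goodSet y y′ = trans (size-onSide i (Vec.tabulate (common y y′))) (∣tabulate∣≡count (common y y′))

  covers⇒commonNbr : ∀ {y y′ w} → Covers y y′ w → T (commonNbrᵇ G (goodSet y y′) (ι (other i) w))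
  covers⇒commonNbr {y} {y′} {w} cov =
    all⁻ _ (universal (vertex-side-elim i on-i on-other) (vertices n₁ n₂))
    where
    S : VSet n₁ n₂
    S = goodSet y y′
    on-i : ∀ x → T (not (memᵇ S (ι i x)) ∨ adj G (ι i x) (ι (other i) w))
    on-i x rewrite memᵇ-onSide i (Vec.tabulate (common y y′)) x | lookup∘tabulate (common y y′) x =
      ⇒not∨ (cov x)
    on-other : ∀ z → T (not (memᵇ S (ι (other i) z)) ∨ adj G (ι (other i) z) (ι (other i) w))
    on-other z rewrite memᵇ-onSide-other i (Vec.tabulate (common y y′)) z = tt

  covers≤dS : ∀ y y′ → count (does ∘ covers? y y′) ≤ dS G (goodSet y y′)
  covers≤dS y y′ = ≤-trans (count-mono-≤ (λ w → covers⇒commonNbr ∘ does⁻ (covers? y y′ w)))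
    (≤-trans (m≤n+m _ _) (≤-reflexive (sym (countV-side i (commonNbrᵇ G (goodSet y y′))))))

  counted-c4At : ∀ {x x′ y y′} → T (toℕ x <ᵇ toℕ x′) → T (toℕ y <ᵇ toℕ y′) → GoodPair y y′ →
    T (common y y′ x) → T (common y y′ x′) → T (counted (c4At i x x′ y y′))
  counted-c4At {x} {x′} {y} {y′} x<x′ y<y′ (codeg≡t , t<|covers|) x∈N x′∈N =
    isC4-c4At G i x x′ y y′ x<x′ y<y′ xy xy′ x′y x′y′
      ∧⁺ does⁺ (hasGoodSet? t G i (c4At i x x′ y y′)) (S , S-witness)
    where
    xy : T (R x y)
    xy = proj₁ (to (T-∧ {R x y}) x∈N)
    xy′ : T (R x y′)
    xy′ = proj₂ (to (T-∧ {R x y}) x∈N)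
    x′y : T (R x′ y)
    x′y = proj₁ (to (T-∧ {R x′ y}) x′∈N)
    x′y′ : T (R x′ y′)
    x′y′ = proj₂ (to (T-∧ {R x′ y}) x′∈N)
    S : VSet n₁ n₂
    S = goodSet y y′
    |S|≡t : size S ≡ t
    |S|≡t = trans (size-goodSet y y′) codeg≡t
    S-witness : T (witnessᵇ t G i (c4At i x x′ y y′) S)
    S-witness = ≡⇒≡ᵇ (size S) t |S|≡t
             ∧⁺ ≤⇒≤ᵇ (subst (λ s → suc s ≤ dS G S) (sym |S|≡t) (≤-trans t<|covers| (covers≤dS y y′)))
             ∧⁺ c4verts-covered i S x x′ y y′ (goodSet-member x∈N) (goodSet-member x′∈N)

  commonPair : Fin k → Fin k → Fin m → Fin m → ℕ
  commonPair y y′ x x′ = 𝟙 ((toℕ x <ᵇ toℕ x′) ∧ (common y y′ x ∧ common y y′ x′))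

  tC2*goodPairs≡ : (t C 2) * goodPairs ≡
    ∑[ y < k ] ∑[ y′ < k ] ∑[ x < m ] ∑[ x′ < m ] (good< y y′ * commonPair y y′ x x′)
  tC2*goodPairs≡ = begin
    (t C 2) * goodPairs
      ≡⟨ *-comm (t C 2) goodPairs ⟩
    goodPairs * (t C 2)
      ≡⟨ trans (*-distribʳ-sum (t C 2) (λ y → ∑[ y′ < k ] good< y y′))
               (sum-cong-≗ (λ y → *-distribʳ-sum (t C 2) (good< y))) ⟩
    ∑[ y < k ] ∑[ y′ < k ] (good< y y′ * (t C 2))
      ≡⟨ sum-cong-≗ (λ y → sum-cong-≗ (λ y′ → 𝟙-*-cong {(toℕ y <ᵇ toℕ y′) ∧ does (goodPair? y y′)}
           (λ g → cong (_C 2) (sym (codeg≡t g))))) ⟩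
    ∑[ y < k ] ∑[ y′ < k ] (good< y y′ * (codeg y y′ C 2))
      ≡⟨ sum-cong-≗ (λ y → sum-cong-≗ (λ y′ → cong (good< y y′ *_) (sym (count-pairs (common y y′))))) ⟩
    ∑[ y < k ] ∑[ y′ < k ] (good< y y′ * ∑[ x < m ] ∑[ x′ < m ] commonPair y y′ x x′)
      ≡⟨ sum-cong-≗ (λ y → sum-cong-≗ (λ y′ →
           trans (*-distribˡ-sum (good< y y′) (λ x → ∑[ x′ < m ] commonPair y y′ x x′))
                 (sum-cong-≗ (λ x → *-distribˡ-sum (good< y y′) (commonPair y y′ x))))) ⟩
    ∑[ y < k ] ∑[ y′ < k ] ∑[ x < m ] ∑[ x′ < m ] (good< y y′ * commonPair y y′ x x′) ∎
    where
    open ≡-Reasoning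
    codeg≡t : ∀ {y y′} → T ((toℕ y <ᵇ toℕ y′) ∧ does (goodPair? y y′)) → codeg y y′ ≡ t
    codeg≡t {y} {y′} g = proj₁ (does⁻ (goodPair? y y′) (proj₂ (to (T-∧ {toℕ y <ᵇ toℕ y′}) g)))

  commonPair-counted : ∀ y y′ x x′ → good< y y′ * commonPair y y′ x x′ ≤ 𝟙 (counted (c4At i x x′ y y′))
  commonPair-counted y y′ x x′ = ≤-trans (≤-reflexive (sym (𝟙-∧ g p))) (𝟙-mono-≤ λ g∧p →
    let y<y′ , good = to (T-∧ {toℕ y <ᵇ toℕ y′}) (proj₁ (to (T-∧ {g}) g∧p))
        x<x′ , x∈N∧x′∈N = to (T-∧ {toℕ x <ᵇ toℕ x′}) (proj₂ (to (T-∧ {g}) g∧p))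
        x∈N , x′∈N = to (T-∧ {common y y′ x}) x∈N∧x′∈N
    in counted-c4At x<x′ y<y′ (does⁻ (goodPair? y y′) good) x∈N x′∈N)
    where
    g p : Bool
    g = (toℕ y <ᵇ toℕ y′) ∧ does (goodPair? y y′)
    p = (toℕ x <ᵇ toℕ x′) ∧ (common y y′ x ∧ common y y′ x′)

  tC2*goodPairs≤N-C4 : (t C 2) * goodPairs ≤ N-C4 t G i
  tC2*goodPairs≤N-C4 = begin
    (t C 2) * goodPairs
      ≡⟨ tC2*goodPairs≡ ⟩
    ∑[ y < k ] ∑[ y′ < k ] ∑[ x < m ] ∑[ x′ < m ] (good< y y′ * commonPair y y′ x x′)
      ≤⟨ ∑-mono-≤ (λ y → ∑-mono-≤ (λ y′ → ∑-mono-≤ (λ x → ∑-mono-≤ (commonPair-counted y y′ x)))) ⟩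
    ∑[ y < k ] ∑[ y′ < k ] ∑[ x < m ] ∑[ x′ < m ] 𝟙 (counted (c4At i x x′ y y′))
      ≡⟨ sym N-C4≡ ⟩
    N-C4 t G i ∎
    where open ≤-Reasoning

m≤n+o⇒+m-+n≤+o : ∀ {m n o : ℕ} → m ≤ n + o → + m - + n ≤ℤ + o
m≤n+o⇒+m-+n≤+o {m} {n} {o} m≤n+o = begin
  + m - + n    ≡⟨ ℤ.[+m]-[+n]≡m⊖n m n ⟩
  m ⊖ n        ≤⟨ ℤ.⊖-monoˡ-≤ n m≤n+o ⟩
  (n + o) ⊖ n  ≡⟨ trans (ℤ.⊖-≥ (m≤m+n n o)) (cong +_ (m+n∸m≡n n o)) ⟩
  + o          ∎
  where open ℤ.≤-Reasoning

i-j-k≡i-[j+k] : ∀ i j k → i - j - k ≡ i - (j +ℤ k)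
i-j-k≡i-[j+k] i j k = trans (ℤ.+-assoc i (- j) (- k)) (cong (i +ℤ_) (sym (ℤ.neg-distrib-+ j k)))

scaled-deficit≤ : ∀ c s a e b q g d n → s ≤ a * e + b * q + g → c * g ≤ d * n →
  (+ c) *ℤ ((+ s) - (+ a) *ℤ (+ e) - (+ b) *ℤ (+ q)) ≤ℤ (+ d) *ℤ (+ n)
scaled-deficit≤ c s a e b q g d n s≤ cg≤dn = begin
  + c *ℤ (+ s - + a *ℤ + e - + b *ℤ + q)  ≡⟨ cong (+ c *ℤ_) deficit≡ ⟩
  + c *ℤ (+ s - + (a * e + b * q))        ≤⟨ ℤ.*-monoˡ-≤-nonNeg (+ c) (m≤n+o⇒+m-+n≤+o s≤) ⟩
  + c *ℤ + g                              ≡⟨ sym (ℤ.pos-* c g) ⟩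
  + (c * g)                               ≤⟨ +≤+ cg≤dn ⟩
  + (d * n)                               ≡⟨ ℤ.pos-* d n ⟩
  + d *ℤ + n                              ∎
  where
  open ℤ.≤-Reasoning
  deficit≡ : + s - + a *ℤ + e - + b *ℤ + q ≡ + s - + (a * e + b * q)
  deficit≡ = trans (i-j-k≡i-[j+k] (+ s) (+ a *ℤ + e) (+ b *ℤ + q))
    (cong (λ u → + s - u) (sym (trans (ℤ.pos-+ (a * e) (b * q)) (cong₂ _+ℤ_ (ℤ.pos-* a e) (ℤ.pos-* b q)))))

t≤2t∸1 : ∀ t → t ≤ 2 * t ∸ 1
t≤2t∸1 zero     = z≤n
t≤2t∸1 (suc t′) = ≤-trans (s≤s (m≤m+n t′ 0)) (m≤n+m (suc (t′ + 0)) t′)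

N-C4-lower-bound : ∀ {n₁ n₂} t′ (G : BipGraph n₁ n₂) → BtFree (suc t′) G → ∀ i →
  (+ (suc t′ C 2)) *ℤ ((+ sumDegSq G i) - (+ (2 * suc t′ ∸ 1)) *ℤ (+ edges G)
                       - (+ t′) *ℤ (+ (partSize n₁ n₂ (other i) ^ 2)))
    ≤ℤ (+ 2) *ℤ (+ N-C4 (suc t′) G i)
N-C4-lower-bound {n₁} {n₂} t′ G free i =
  scaled-deficit≤ (t C 2) (sumDegSq G i) (2 * t ∸ 1) (edges G) t′ (k ^ 2) (2 * goodPairs) 2 (N-C4 t G i)
    (begin
      sumDegSq G i                                  ≡⟨ sumDegSq-side G i ⟩
      ∑[ x < partSize n₁ n₂ i ] (deg x * deg x)     ≤⟨ ∑deg²≤ (BtFree⇒¬BtPattern t′ G i free) ⟩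
      t * edgeCount + t′ * (k * k) + 2 * goodPairs  ≤⟨ +-monoˡ-≤ _ (+-mono-≤ (*-monoˡ-≤ edgeCount (t≤2t∸1 t)) k*k≤k²) ⟩
      (2 * t ∸ 1) * edgeCount + t′ * (k ^ 2) + 2 * goodPairs
        ≡⟨ cong (λ e → (2 * t ∸ 1) * e + t′ * (k ^ 2) + 2 * goodPairs) (sym (edges-side G i)) ⟩
      (2 * t ∸ 1) * edges G + t′ * (k ^ 2) + 2 * goodPairs ∎)
    (begin
      (t C 2) * (2 * goodPairs)  ≡⟨ *-comm-middle ⟩
      2 * ((t C 2) * goodPairs)  ≤⟨ *-monoʳ-≤ 2 (CountC4.tC2*goodPairs≤N-C4 t′ G i) ⟩
      2 * N-C4 t G i             ∎)
  where
  open Codegrees (sideRel G i) t′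
  open ≤-Reasoning
  k : ℕ
  k = partSize n₁ n₂ (other i)
  k*k≤k² : t′ * (k * k) ≤ t′ * (k ^ 2)
  k*k≤k² = ≤-reflexive (cong (λ z → t′ * (k * z)) (sym (*-identityʳ k)))
  *-comm-middle : (t C 2) * (2 * goodPairs) ≡ 2 * ((t C 2) * goodPairs)
  *-comm-middle = trans (sym (*-assoc (t C 2) 2 goodPairs))
                        (trans (cong (_* goodPairs) (*-comm (t C 2) 2)) (*-assoc 2 (t C 2) goodPairs))

lemma2p2 : (t : ℕ) → 1 ≤ t →
    ∃[ n₀ ] ((n₁ n₂ : ℕ) → n₀ ≤ n₁ + n₂ → (G : BipGraph n₁ n₂) → BtFree t G →
      (i j : Part) → i ≢ j →
      (+ (t C 2)) *ℤ ((+ sumDegSq G i) - (+ (2 * t ∸ 1)) *ℤ (+ edges G)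
                       - (+ (t ∸ 1)) *ℤ (+ (partSize n₁ n₂ j ^ 2)))
        ≤ℤ (+ 2) *ℤ (+ N-C4 t G i))
lemma2p2 (suc t′) _ = 0 , λ where
  _ _ _ G free one two _   → N-C4-lower-bound t′ G free one
  _ _ _ G free two one _   → N-C4-lower-bound t′ G free two
  _ _ _ _ _    one one 1≢1 → ⊥-elim (1≢1 refl)
  _ _ _ _ _    two two 2≢2 → ⊥-elim (2≢2 refl)
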